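{- Let $n \geq 1$ be an integer, $p$ an odd prime, and $\lambda$ an integer with $1 \leq \lambda < p$. Write the base-$p$ expansion $n = a_0 + a_1 p + a_2 p^2 + \cdots$ with digits $0 \leq a_k \leq p-1$. If $\frac{n+1}{\lambda+1} < p < \frac{n+1}{\lambda}$ and $a_0 < p - \lambda$, then $s_p(n) < p$.
   Context: $s_p(n)$ denotes the sum of the digits of $n$ in base $p$. -}

module Defs where

open import Data.Nat using (ℕ; zero; suc; _+_; _<_; NonZero)
open import Data.Nat.DivMod using (_/_; _%_)

-- Sum of the base-p digits of n, computed with a fuel parameter.
-- With fuel ≥ n (and p ≥ 2) the recursion reaches 0, since n / p < n for n ≥ 1.
digitSumAux : (p : ℕ) → .{{_ : NonZero p}} → ℕ → ℕ → ℕ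
digitSumAux p zero    n = 0
digitSumAux p (suc k) zero = 0
digitSumAux p (suc k) n@(suc _) = n % p + digitSumAux p k (n / p)

s : (p : ℕ) → .{{_ : NonZero p}} → ℕ → ℕ
s p n = digitSumAux p n n

module Submission where

-- Write n = a₀ + q·p with a₀ = n % p and q = n / p.  Peeling off
-- the lowest digit gives s_p(n) = a₀ + s_p(q), and a digit sum never exceeds
-- the number itself, so s_p(n) ≤ a₀ + q.  The upper bound n + 1 < p(λ + 1)
-- forces q ≤ λ, and the digit hypothesis a₀ < p − λ gives a₀ + λ < p.
-- Hence s_p(n) ≤ a₀ + q ≤ a₀ + λ < p.

open import Defs
open import Data.Nat using (ℕ; zero; suc; _+_; _*_; _∸_; _<_; _≤_; NonZero; z≤n)
open import Data.Nat.DivMod using (_/_; _%_; m≡m%n+[m/n]*n; m<n*o⇒m/o<n)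
open import Data.Nat.Properties
open import Data.Nat.Primality using (Prime)
open import Relation.Binary.PropositionalEquality

digitSumAux-≤ : (p : ℕ) → .{{_ : NonZero p}} → (fuel m : ℕ) →
  digitSumAux p fuel m ≤ m
digitSumAux-≤ p zero    m       = z≤n
digitSumAux-≤ p (suc k) zero    = z≤n
digitSumAux-≤ p (suc k) m@(suc _) = begin
  m % p + digitSumAux p k (m / p) ≤⟨ +-monoʳ-≤ (m % p) (digitSumAux-≤ p k (m / p)) ⟩
  m % p + m / p                   ≤⟨ +-monoʳ-≤ (m % p) (m≤m*n (m / p) p) ⟩
  m % p + m / p * p               ≡⟨ m≡m%n+[m/n]*n m p ⟨
  m                               ∎
  where open ≤-Reasoning

digitSum-≤-lastDigit+quotient : (p : ℕ) → .{{_ : NonZero p}} → (n : ℕ) → 1 ≤ n →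
  s p n ≤ n % p + n / p
digitSum-≤-lastDigit+quotient p (suc m) _ =
  +-monoʳ-≤ (suc m % p) (digitSumAux-≤ p m (suc m / p))

quotient-≤ : (n p l : ℕ) → .{{_ : NonZero p}} → n + 1 < p * (l + 1) → n / p ≤ l
quotient-≤ n p l n+1<p[l+1] = ≤-pred (subst (n / p <_) (+-comm l 1) q<l+1)
  where
  n<[l+1]p : n < (l + 1) * p
  n<[l+1]p = <-trans (m<m+n n ≤-refl) (subst (n + 1 <_) (*-comm p (l + 1)) n+1<p[l+1])
  q<l+1 : n / p < l + 1
  q<l+1 = m<n*o⇒m/o<n {n} {l + 1} {p} n<[l+1]p

+-<-from-<∸ : (a p l : ℕ) → l ≤ p → a < p ∸ l → a + l < p
+-<-from-<∸ a p l l≤p a<p∸l = subst (a + l <_) (m∸n+n≡m l≤p) (+-monoˡ-< l a<p∸l)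

lemma3 : (n p l : ℕ) → .{{_ : NonZero p}} → 1 ≤ n → Prime p → p % 2 ≡ 1 →
    1 ≤ l → l < p →
    n + 1 < p * (l + 1) → p * l < n + 1 →
    n % p < p ∸ l →
    s p n < p
lemma3 n p l 1≤n _ _ _ l<p upper _ digit = begin-strict
  s p n         ≤⟨ digitSum-≤-lastDigit+quotient p n 1≤n ⟩
  n % p + n / p ≤⟨ +-monoʳ-≤ (n % p) (quotient-≤ n p l upper) ⟩
  n % p + l     <⟨ +-<-from-<∸ (n % p) p l (<⇒≤ l<p) digit ⟩
  p             ∎
  where open ≤-Reasoning
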